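{- Let $F$ be a partially colored forest. If Alice has a winning strategy in the $3$-Reduced Coloring Game ($3$-RCG) on $\mathcal{R}'(F)$, then Alice has a winning strategy in the $3$-coloring game on $F$.
   Context: The $k$-coloring game on a (possibly partially colored, properly) graph with a set of $k$ colors: a color is legal for a vertex $v$ if no neighbor of $v$ has that color. Alice and Bob alternately color uncolored vertices with legal colors, Alice moving first. If at any point some uncolored vertex has no legal color, Bob wins; Alice wins once every vertex is colored. The $k$-RCG is the same as the $k$-coloring game except that Alice may only color vertices of degree at least $k$, Alice wins once every vertex of degree at least $k$ is colored, Bob moves first, and Bob may pass. For a partially colored forest $F$, a trunk is a maximal connected subgraph in which every colored vertex is a leaf; $\mathcal{R}(F)$ is the disjoint union of all trunks of $F$ (a colored vertex of degree $d$ appears as $d$ separate copies). For a graph $G$, $E_{>2}(G)=\{xy\in E(G): d(x)>2 \text{ or } d(y)>2\}$ and $E_{>>2}(G)=\{xy\in E(G): d(x)>2\text{ and } d(y)>2\}$. The reduced graph $\mathcal{R}'(F)$ is obtained from $\mathcal{R}(F)$ by deleting every edge not in $E_{>2}(\mathcal{R}(F))$, degrees being computed in $\mathcal{R}(F)$. -}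

module Defs where

open import Data.Nat using (ℕ; suc; _≤_)
open import Data.Bool using (Bool; T)
open import Data.Fin using (Fin)
open import Data.Fin.Subset using (Subset; _∈_; _⊆_; ∣_∣)
open import Data.Maybe using (Maybe; just; nothing)
open import Data.Vec using (Vec; lookup)
open import Data.List using (List; []; _∷_; _++_; [_]; length)
open import Data.List.Relation.Unary.All using (All)
open import Data.List.Relation.Unary.Unique.Propositional using (Unique)
open import Data.Product using (Σ; ∃; _×_)
open import Data.Sum using (_⊎_)
open import Relation.Nullary using (¬_)
open import Relation.Binary.PropositionalEquality using (_≡_; _≢_)
open import Relation.Binary.Construct.Closure.ReflexiveTransitive using (Star)

DegAtLeast : {V : Set} → (V → V → Set) → ℕ → V → Set
DegAtLeast {V} Adj k v =
  Σ (List V) λ xs → length xs ≡ k × Unique xs × All (Adj v) xs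

module Game {V : Set} (Adj : V → V → Set) (k : ℕ) where

  Coloring : Set
  Coloring = V → Maybe (Fin k)

  Uncolored : Coloring → V → Set
  Uncolored c v = c v ≡ nothing

  Legal : Coloring → V → Fin k → Set
  Legal c v a = ∀ w → Adj v w → c w ≢ just a

  NoDead : Coloring → Set
  NoDead c = ∀ v → Uncolored c v → ¬ (∀ a → ¬ Legal c v a)

  AllColored : Coloring → Set
  AllColored c = ∀ v → ∃ λ a → c v ≡ just a

  Update : Coloring → V → Fin k → Coloring → Set
  Update c v a c' = c' v ≡ just a × (∀ w → w ≢ v → c' w ≡ c w)

  -- AliceWins c : Alice (to move) has a winning strategy
  -- from c;  BobToMoveAliceWins c : Alice has a winning strategy from c
  -- when it is Bob's turn.  (Inductive = finite winning strategy.)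
  mutual
    data AliceWins (c : Coloring) : Set where
      a-done : AllColored c → AliceWins c
      a-move : NoDead c → (v : V) (a : Fin k) → Uncolored c v → Legal c v a →
               (c' : Coloring) → Update c v a c' → BobToMoveAliceWins c' →
               AliceWins c

    data BobToMoveAliceWins (c : Coloring) : Set where
      b-done : AllColored c → BobToMoveAliceWins c
      b-move : NoDead c →
               ((v : V) (a : Fin k) → Uncolored c v → Legal c v a →
                (c' : Coloring) → Update c v a c' → AliceWins c') →
               BobToMoveAliceWins c

  High : V → Set
  High = DegAtLeast Adj k

  AllHighColored : Coloring → Set
  AllHighColored c = ∀ v → High v → ∃ λ a → c v ≡ just a

  mutual
    data RCG-AliceWins (c : Coloring) : Set where
      ra-done : NoDead c → AllHighColored c → RCG-AliceWins c
      ra-move : NoDead c → (v : V) (a : Fin k) → High v → Uncolored c v →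
                Legal c v a → (c' : Coloring) → Update c v a c' →
                RCG-BobToMoveAliceWins c' → RCG-AliceWins c

    data RCG-BobToMoveAliceWins (c : Coloring) : Set where
      rb-done : NoDead c → AllHighColored c → RCG-BobToMoveAliceWins c
      rb-move : NoDead c →
                RCG-AliceWins c →   -- Bob passes
                ((v : V) (a : Fin k) → Uncolored c v → Legal c v a →
                 (c' : Coloring) → Update c v a c' → RCG-AliceWins c') →
                RCG-BobToMoveAliceWins c

  AliceWinsColoringGame : Coloring → Set
  AliceWinsColoringGame = AliceWins

  -- Alice has a winning strategy in the k-RCG (Bob first)
  AliceWinsRCG : Coloring → Set
  AliceWinsRCG = RCG-BobToMoveAliceWins

data Path {n : ℕ} (adj : Fin n → Fin n → Bool) : List (Fin n) → Set where
  p-nil  : Path adj []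
  p-one  : ∀ x → Path adj [ x ]
  p-cons : ∀ x y xs → T (adj x y) → Path adj (y ∷ xs) → Path adj (x ∷ y ∷ xs)

IsCycle : {n : ℕ} → (Fin n → Fin n → Bool) → List (Fin n) → Set
IsCycle adj []       = Data.Empty.⊥ where import Data.Empty
IsCycle adj (x ∷ xs) = 2 ≤ length xs × Unique (x ∷ xs) × Path adj (x ∷ xs ++ [ x ])

record Forest (n : ℕ) : Set where
  field
    adj     : Fin n → Fin n → Bool
    sym     : ∀ u v → adj u v ≡ adj v u
    irrefl  : ∀ v → adj v v ≡ Bool.false
    acyclic : ∀ cyc → ¬ IsCycle adj cyc
open Forest public

FAdj : {n : ℕ} → Forest n → Fin n → Fin n → Set
FAdj F u v = T (adj F u v)

PColoring : ℕ → Set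
PColoring n = Fin n → Maybe (Fin 3)

Proper : {n : ℕ} → Forest n → PColoring n → Set
Proper F c = ∀ u v a → FAdj F u v → c u ≡ just a → c v ≢ just a

record Subgraph (n : ℕ) : Set where
  constructor sg
  field
    vs : Subset n
    es : Vec (Subset n) n
open Subgraph public

SEdge : {n : ℕ} → Subgraph n → Fin n → Fin n → Set
SEdge S u v = v ∈ lookup (es S) u

IsSubgraphOf : {n : ℕ} → Forest n → Subgraph n → Set
IsSubgraphOf F S =
  (∀ u v → SEdge S u v → FAdj F u v × u ∈ vs S × v ∈ vs S) ×
  (∀ u v → SEdge S u v → SEdge S v u)

Connected : {n : ℕ} → Subgraph n → Set
Connected S = ∀ u v → u ∈ vs S → v ∈ vs S → Star (SEdge S) u v

SDeg : {n : ℕ} → Subgraph n → Fin n → ℕ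
SDeg S v = ∣ lookup (es S) v ∣

TrunkCandidate : {n : ℕ} → Forest n → PColoring n → Subgraph n → Set
TrunkCandidate F c S =
  IsSubgraphOf F S × Connected S ×
  (∀ v → v ∈ vs S → c v ≢ nothing → SDeg S v ≡ 1)

_⊆S_ : {n : ℕ} → Subgraph n → Subgraph n → Set
S ⊆S S' = (vs S ⊆ vs S') × (∀ u → lookup (es S) u ⊆ lookup (es S') u)

IsTrunk : {n : ℕ} → Forest n → PColoring n → Subgraph n → Set
IsTrunk F c S =
  TrunkCandidate F c S × (∀ S' → TrunkCandidate F c S' → S ⊆S S' → S' ≡ S)

-- vertices of R(F) = disjoint union of all trunks: a trunk together with
-- one of its vertices (proofs are irrelevant, so each pair is one vertex)
record RVert {n : ℕ} (F : Forest n) (c : PColoring n) : Set where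
  constructor rv
  field
    trunk     : Subgraph n
    .isTrunk  : IsTrunk F c trunk
    vtx       : Fin n
    .inTrunk  : vtx ∈ vs trunk
open RVert public

RAdj : {n : ℕ} {F : Forest n} {c : PColoring n} → RVert F c → RVert F c → Set
RAdj x y = trunk x ≡ trunk y × SEdge (trunk x) (vtx x) (vtx y)

RColoring : {n : ℕ} (F : Forest n) (c : PColoring n) → RVert F c → Maybe (Fin 3)
RColoring F c x = c (vtx x)

-- delete every edge not in E_{>2}(G) (degrees computed in G)
Reduce : {V : Set} → (V → V → Set) → V → V → Set
Reduce Adj x y = Adj x y × (DegAtLeast Adj 3 x ⊎ DegAtLeast Adj 3 y)

R'Adj : {n : ℕ} (F : Forest n) (c : PColoring n) → RVert F c → RVert F c → Set
R'Adj F c = Reduce (RAdj {F = F} {c = c})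

module Submission where

-- Every uncolored vertex u of F lies in exactly one trunk, hence has exactly
-- one copy in R(F), and the neighbours of that copy are copies of the
-- neighbours of u.  Alice answers in F with the moves of her RCG strategy,
-- and every move of Bob in F is mirrored by the same move on the copy.  All
-- edges at a copy of degree ≥ 3 survive in R'(F); so Alice's moves stay legal
-- in F, and a dead vertex of F (which needs three neighbours) has a dead copy
-- in R'(F).  Once the RCG is won, every uncolored vertex of F has degree < 3,
-- and then every play of the coloring game is won by Alice.

open import Defs hiding (sym)
open import Data.Nat using (ℕ; zero; suc; _+_; _≤_; _<_; z≤n; s≤s; _≤′_; ≤′-refl; ≤′-step)
open import Data.Nat.Properties
  using (<-irrefl; <-≤-trans; ≤-<-trans; ≤-refl; ≤-pred; <⇒≤; ≤⇒≤′; +-suc; +-identityʳ)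
open import Data.Bool using (T)
open import Data.Fin using (Fin; zero; suc; _≟_)
open import Data.Fin.Properties using (any?; all?; ¬∀⟶∃¬; injective⇒≤)
open import Data.Fin.Subset using (Subset; _∈_; _⊆_; ∣_∣; ⁅_⁆; _-_)
open import Data.Fin.Subset.Properties
  using (_∈?_; x∈p⇒∣p-x∣<∣p∣; x∈p∧x≢y⇒x∈p-y; p⊆q⇒∣p∣≤∣q∣; x∈⁅y⁆⇒x≡y; x∈⁅x⁆; ∣⁅x⁆∣≡1; ⊆-antisym)
open import Data.Maybe using (Maybe; just; nothing)
open import Data.Maybe.Properties using (≡-dec; just-injective)
open import Data.Vec using (lookup; tabulate)
import Data.Vec.Properties as Vec
import Data.Bool.Properties as Bool
open import Data.Vec.Properties
  using ([]=⇒lookup; lookup⇒[]=; lookup∘tabulate; tabulate∘lookup; tabulate-cong)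
open import Data.List using (List; []; _∷_; _++_; [_]; length)
import Data.List as List
open import Data.List.Relation.Unary.All using (All; []; _∷_)
import Data.List.Relation.Unary.All as All
import Data.List.Relation.Unary.All.Properties as All
open import Data.List.Relation.Unary.Any using (here; there)
open import Data.List.Relation.Unary.All.Properties.Core using (¬Any⇒All¬)
open import Data.List.Relation.Unary.AllPairs using ([]; _∷_)
open import Data.List.Relation.Unary.Unique.Propositional using (Unique)
import Data.List.Relation.Unary.Unique.Propositional.Properties as Unique
open import Data.List.Properties using (length-tabulate)
open import Data.List.Membership.Propositional using () renaming (_∈_ to _∈ₗ_)
open import Data.List.Membership.Propositional.Properties using (∈-lookup)
open import Data.Product using (Σ; ∃; _×_; _,_; proj₁; proj₂)
open import Data.Sum using (_⊎_; inj₁; inj₂)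
open import Data.Empty using (⊥-elim)
open import Relation.Unary using (Decidable)
open import Relation.Nullary using (¬_; Dec; yes; no; does; ¬?)
open import Relation.Nullary.Decidable using (dec-true; recompute; T?; _⊎-dec_; _×-dec_; _→-dec_)
open import Relation.Binary.Construct.Closure.ReflexiveTransitive using (Star; ε; _◅_; _◅◅_; reverse)
open import Relation.Binary.PropositionalEquality using (_≡_; _≢_; refl; sym; trans; cong; cong₂; subst)
open Relation.Binary.PropositionalEquality.≡-Reasoning

subsetOf : ∀ {n} {P : Fin n → Set} → Decidable P → Subset n
subsetOf P? = tabulate (λ u → does (P? u))

∈-subsetOf⁻ : ∀ {n} {P : Fin n → Set} (P? : Decidable P) {u} → u ∈ subsetOf P? → P u
∈-subsetOf⁻ P? {u} m with P? u | trans (sym (lookup∘tabulate (λ u → does (P? u)) u)) ([]=⇒lookup m)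
... | yes p | _ = p
... | no _  | ()

∈-subsetOf⁺ : ∀ {n} {P : Fin n → Set} (P? : Decidable P) {u} → P u → u ∈ subsetOf P?
∈-subsetOf⁺ P? {u} p = lookup⇒[]= u _ (trans (lookup∘tabulate (λ u → does (P? u)) u) (dec-true (P? u) p))

subgraph-≟ : ∀ {n} (S T : Subgraph n) → Dec (S ≡ T)
subgraph-≟ (sg vs₁ es₁) (sg vs₂ es₂)
  with Vec.≡-dec Bool._≟_ vs₁ vs₂ | Vec.≡-dec (Vec.≡-dec Bool._≟_) es₁ es₂
... | yes refl  | yes refl  = yes refl
... | no vs₁≢vs₂ | _        = no λ eq → vs₁≢vs₂ (cong vs eq)
... | _         | no es₁≢es₂ = no λ eq → es₁≢es₂ (cong es eq)

just≢nothing : ∀ {A : Set} {a : A} → just a ≢ nothing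
just≢nothing ()

size1⇒≡ : ∀ {n} (p : Subset n) {x y} → ∣ p ∣ ≡ 1 → x ∈ p → y ∈ p → y ≡ x
size1⇒≡ p {x} {y} ∣p∣≡1 x∈p y∈p with y ≟ x
... | yes y≡x = y≡x
... | no y≢x = ⊥-elim (<-irrefl refl (<-≤-trans ∣p-x∣<1 1≤∣p-x∣))
  where
  ∣p-x∣<1 : ∣ p - x ∣ < 1
  ∣p-x∣<1 = subst (∣ p - x ∣ <_) ∣p∣≡1 (x∈p⇒∣p-x∣<∣p∣ x∈p)
  ⁅y⁆⊆p-x : ⁅ y ⁆ ⊆ p - x
  ⁅y⁆⊆p-x z∈⁅y⁆ = subst (_∈ p - x) (sym (x∈⁅y⁆⇒x≡y y z∈⁅y⁆)) (x∈p∧x≢y⇒x∈p-y y∈p y≢x)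
  1≤∣p-x∣ : 1 ≤ ∣ p - x ∣
  1≤∣p-x∣ = subst (_≤ ∣ p - x ∣) (∣⁅x⁆∣≡1 y) (p⊆q⇒∣p∣≤∣q∣ ⁅y⁆⊆p-x)

unique⇒length≤ : ∀ {n} (xs : List (Fin n)) → Unique xs → length xs ≤ n
unique⇒length≤ xs xs! = injective⇒≤ (lookup-injective xs xs!)
  where
  lookup-injective : ∀ {A : Set} (ys : List A) → Unique ys →
                     ∀ {i j} → List.lookup ys i ≡ List.lookup ys j → i ≡ j
  lookup-injective (y ∷ ys) _            {zero}  {zero}  _  = refl
  lookup-injective (y ∷ ys) (y∉ys ∷ _)   {zero}  {suc j} eq = ⊥-elim (All.lookup y∉ys (∈-lookup j) eq)
  lookup-injective (y ∷ ys) (y∉ys ∷ _)   {suc i} {zero}  eq = ⊥-elim (All.lookup y∉ys (∈-lookup i) (sym eq))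
  lookup-injective (y ∷ ys) (_ ∷ ys!)    {suc i} {suc j} eq = cong suc (lookup-injective ys ys! eq)

-- Their one
-- essential property is that they cannot close a cycle through a colored
-- vertex: two distinct neighbours of a colored vertex are never joined by an
-- uncolored walk.
module UncoloredWalks {n : ℕ} (F : Forest n) (c : PColoring n) where
  open import Data.List.Membership.DecPropositional (_≟_ {n}) using () renaming (_∈?_ to _∈ₗ?_)

  Uncolored : Fin n → Set
  Uncolored u = c u ≡ nothing

  uncolored? : Decidable Uncolored
  uncolored? u with c u
  ... | nothing = yes refl
  ... | just _  = no λ ()

  E : Fin n → Fin n → Set
  E = FAdj F

  E-sym : ∀ {u w} → E u w → E w u
  E-sym {u} {w} = subst T (Forest.sym F u w)

  data Walk : Fin n → Fin n → Set where
    stop : ∀ {a} → Uncolored a → Walk a a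
    step : ∀ {a b d} → Uncolored a → E a b → Walk b d → Walk a d

  mutual
    vertices : ∀ {a b} → Walk a b → List (Fin n)
    vertices {a} w = a ∷ laterVertices w

    laterVertices : ∀ {a b} → Walk a b → List (Fin n)
    laterVertices (stop _)     = []
    laterVertices (step _ _ w) = vertices w

  len : ∀ {a b} → Walk a b → ℕ
  len w = length (laterVertices w)

  allUncolored : ∀ {a b} (w : Walk a b) → All Uncolored (vertices w)
  allUncolored (stop ua)     = ua ∷ []
  allUncolored (step ua _ w) = ua ∷ allUncolored w

  startUncolored : ∀ {a b} → Walk a b → Uncolored a
  startUncolored (stop ua)     = ua
  startUncolored (step ua _ _) = ua

  endUncolored : ∀ {a b} → Walk a b → Uncolored b
  endUncolored (stop ub)     = ub
  endUncolored (step _ _ w) = endUncolored w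

  _++ʷ_ : ∀ {a b d} → Walk a b → Walk b d → Walk a d
  stop _       ++ʷ w' = w'
  step ua e w  ++ʷ w' = step ua e (w ++ʷ w')

  snoc : ∀ {a b d} → Walk a b → E b d → Uncolored d → Walk a d
  snoc w e ud = w ++ʷ step (endUncolored w) e (stop ud)

  reverseʷ : ∀ {a b} → Walk a b → Walk b a
  reverseʷ (stop ua)     = stop ua
  reverseʷ (step ua e w) = snoc (reverseʷ w) (E-sym e) ua

  SimpleWalk : Fin n → Fin n → Set
  SimpleWalk a b = Σ (Walk a b) λ w → Unique (vertices w)

  suffixFrom : ∀ {b d x} (w : Walk b d) → x ∈ₗ vertices w → Unique (vertices w) → SimpleWalk x d
  suffixFrom w            (here refl) w! = w , w!
  suffixFrom (stop _)     (there ())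
  suffixFrom (step _ _ w) (there x∈w) (_ ∷ w!) = suffixFrom w x∈w w!

  simplify : ∀ {a b} → Walk a b → SimpleWalk a b
  simplify (stop ua) = stop ua , [] ∷ []
  simplify (step {a} ua e w) with simplify w
  ... | s , s! with a ∈ₗ? vertices s
  ...   | yes a∈s = suffixFrom s a∈s s!
  ...   | no  a∉s = step ua e s , ¬Any⇒All¬ _ a∉s ∷ s!

  pathThrough : ∀ {a b d} (w : Walk a b) → E b d → Path (adj F) (vertices w ++ [ d ])
  pathThrough {d = d} (stop {a} _)          e' = p-cons a d [] e' (p-one d)
  pathThrough {d = d} (step {a} {b} _ e w) e' = p-cons a b (laterVertices w ++ [ d ]) e (pathThrough w e')

  -- A colored vertex x with neighbours u₁ ≠ u₂ and an uncolored walk u₁ → u₂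
  -- would give the cycle x u₁ … u₂ x in the forest F.
  colored-separates : ∀ {x u₁ u₂} → ¬ Uncolored x → u₁ ≢ u₂ → E x u₁ → E u₂ x → ¬ Walk u₁ u₂
  colored-separates {x} {u₁} x-col u₁≢u₂ e₁ e₂ walk with simplify walk
  ... | stop _ , _ = u₁≢u₂ refl
  ... | s@(step _ _ w) , s! =
    acyclic F (x ∷ vertices s) (s≤s (s≤s z≤n) , x∉s (vertices s) (allUncolored s) ∷ s! ,
                                 p-cons x u₁ (vertices w ++ [ x ]) e₁ (pathThrough s e₂))
    where
    x∉s : ∀ ys → All Uncolored ys → All (x ≢_) ys
    x∉s []       []         = []
    x∉s (y ∷ ys) (uy ∷ uys) = (λ x≡y → x-col (subst Uncolored (sym x≡y) uy)) ∷ x∉s ys uys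

  -- Its interior U is the set of
  -- vertices reachable from v by uncolored walks (computed by breadth-first
  -- levels, so that it is a decidable subset); its vertices are U together
  -- with the colored neighbours of U, and its edges are the edges of F
  -- meeting U.
  module TrunkAt (v : Fin n) (uv : Uncolored v) where

    Grow : Subset n → Fin n → Set
    Grow R u = u ∈ R ⊎ (Uncolored u × ∃ λ r → r ∈ R × E r u)

    grow? : ∀ R → Decidable (Grow R)
    grow? R u = u ∈? R ⊎-dec (uncolored? u ×-dec any? (λ r → r ∈? R ×-dec T? (adj F r u)))

    level : ℕ → Subset n
    level zero    = ⁅ v ⁆
    level (suc k) = subsetOf (grow? (level k))

    level-suc : ∀ k {u} → Grow (level k) u → u ∈ level (suc k)
    level-suc k = ∈-subsetOf⁺ (grow? (level k))

    level-sound : ∀ k {u} → u ∈ level k → Walk v u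
    level-sound zero    u∈ = subst (Walk v) (sym (x∈⁅y⁆⇒x≡y v u∈)) (stop uv)
    level-sound (suc k) u∈ with ∈-subsetOf⁻ (grow? (level k)) u∈
    ... | inj₁ u∈′                = level-sound k u∈′
    ... | inj₂ (uu , r , r∈ , e) = snoc (level-sound k r∈) e uu

    level-mono : ∀ {k m u} → k ≤′ m → u ∈ level k → u ∈ level m
    level-mono ≤′-refl         u∈ = u∈
    level-mono (≤′-step {m} p) u∈ = level-suc m (inj₁ (level-mono p u∈))

    level-walk : ∀ {a u} k → a ∈ level k → (w : Walk a u) → u ∈ level (len w + k)
    level-walk k a∈ (stop _) = a∈
    level-walk {u = u} k a∈ (step _ e w) =
      subst (λ j → u ∈ level j) (+-suc (len w) k)
            (level-walk (suc k) (level-suc k (inj₂ (startUncolored w , _ , a∈ , e))) w)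

    U : Subset n
    U = level n

    v∈U : v ∈ U
    v∈U = level-mono {m = n} (≤⇒≤′ z≤n) (x∈⁅x⁆ v)

    walkTo : ∀ {u} → u ∈ U → Walk v u
    walkTo = level-sound n

    U-uncolored : ∀ {u} → u ∈ U → Uncolored u
    U-uncolored u∈U = endUncolored (walkTo u∈U)

    -- U is closed under uncolored neighbours: a simple walk has fewer than n
    -- edges, so n levels suffice.
    U-closed : ∀ {u w} → u ∈ U → Uncolored w → E u w → w ∈ U
    U-closed u∈U uw e with simplify (snoc (walkTo u∈U) e uw)
    ... | s , s! = level-mono {m = n} (≤⇒≤′ len+0≤n) (level-walk 0 (x∈⁅x⁆ v) s)
      where
      len+0≤n : len s + 0 ≤ n
      len+0≤n = subst (_≤ n) (sym (+-identityʳ (len s))) (<⇒≤ (unique⇒length≤ (vertices s) s!))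

    Leaf : Fin n → Set
    Leaf u = ¬ Uncolored u × ∃ λ r → r ∈ U × E r u

    InTrunk : Fin n → Set
    InTrunk u = u ∈ U ⊎ Leaf u

    inTrunk? : Decidable InTrunk
    inTrunk? u = u ∈? U ⊎-dec (¬? (uncolored? u) ×-dec any? (λ r → r ∈? U ×-dec T? (adj F r u)))

    TrunkEdge : Fin n → Fin n → Set
    TrunkEdge u w = E u w × (u ∈ U ⊎ w ∈ U)

    trunkEdge? : ∀ u → Decidable (TrunkEdge u)
    trunkEdge? u w = T? (adj F u w) ×-dec (u ∈? U ⊎-dec w ∈? U)

    neighbours : Fin n → Subset n
    neighbours u = subsetOf (trunkEdge? u)

    S : Subgraph n
    S = sg (subsetOf inTrunk?) (tabulate neighbours)

    edge⁻ : ∀ {u w} → SEdge S u w → TrunkEdge u w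
    edge⁻ {u} {w} m = ∈-subsetOf⁻ (trunkEdge? u) (subst (w ∈_) (lookup∘tabulate neighbours u) m)

    edge⁺ : ∀ {u w} → TrunkEdge u w → SEdge S u w
    edge⁺ {u} {w} p = subst (w ∈_) (sym (lookup∘tabulate neighbours u)) (∈-subsetOf⁺ (trunkEdge? u) p)

    U⊆S : ∀ {u} → u ∈ U → u ∈ vs S
    U⊆S u∈U = ∈-subsetOf⁺ inTrunk? (inj₁ u∈U)

    v∈S : v ∈ vs S
    v∈S = U⊆S v∈U

    neighbour∈S : ∀ {u w} → u ∈ U → E u w → w ∈ vs S
    neighbour∈S {u} {w} u∈U e with uncolored? w
    ... | yes uw = U⊆S (U-closed u∈U uw e)
    ... | no ¬uw = ∈-subsetOf⁺ inTrunk? (inj₂ (¬uw , u , u∈U , e))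

    edge-sym : ∀ {u w} → SEdge S u w → SEdge S w u
    edge-sym m with edge⁻ m
    ... | e , inj₁ u∈U = edge⁺ (E-sym e , inj₂ u∈U)
    ... | e , inj₂ w∈U = edge⁺ (E-sym e , inj₁ w∈U)

    endpoint∈S : ∀ {u w} → TrunkEdge u w → u ∈ vs S
    endpoint∈S (e , inj₁ u∈U) = U⊆S u∈U
    endpoint∈S (e , inj₂ w∈U) = neighbour∈S w∈U (E-sym e)

    S-subgraph : IsSubgraphOf F S
    S-subgraph = (λ u w m → proj₁ (edge⁻ m) , endpoint∈S (edge⁻ m) , endpoint∈S (edge⁻ (edge-sym m))) ,
                 (λ u w → edge-sym)

    walk⇒star : ∀ {a u} → a ∈ U → Walk a u → Star (SEdge S) a u
    walk⇒star a∈U (stop _)      = ε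
    walk⇒star a∈U (step _ e w) = edge⁺ (e , inj₁ a∈U) ◅ walk⇒star (U-closed a∈U (startUncolored w) e) w

    star-from-v : ∀ {u} → u ∈ vs S → Star (SEdge S) v u
    star-from-v u∈S with ∈-subsetOf⁻ inTrunk? u∈S
    ... | inj₁ u∈U                = walk⇒star v∈U (walkTo u∈U)
    ... | inj₂ (_ , r , r∈U , e) = walk⇒star v∈U (walkTo r∈U) ◅◅ (edge⁺ (e , inj₁ r∈U) ◅ ε)

    S-connected : Connected S
    S-connected u w u∈S w∈S = reverse edge-sym (star-from-v u∈S) ◅◅ star-from-v w∈S

    -- A colored vertex u of S is adjacent in S only to the vertex r ∈ U that
    -- put it there: any other S-neighbour lies in U and is joined to r by an
    -- uncolored walk, contradicting colored-separates.
    S-leaves : ∀ u → u ∈ vs S → c u ≢ nothing → SDeg S u ≡ 1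
    S-leaves u u∈S u-col with ∈-subsetOf⁻ inTrunk? u∈S
    ... | inj₁ u∈U = ⊥-elim (u-col (U-uncolored u∈U))
    ... | inj₂ (_ , r , r∈U , e) =
      trans (cong ∣_∣ (lookup∘tabulate neighbours u)) (trans (cong ∣_∣ (⊆-antisym only-r r∈)) (∣⁅x⁆∣≡1 r))
      where
      only-r : neighbours u ⊆ ⁅ r ⁆
      only-r {w} w∈ with ∈-subsetOf⁻ (trunkEdge? u) w∈
      ... | _  , inj₁ u∈U = ⊥-elim (u-col (U-uncolored u∈U))
      ... | e′ , inj₂ w∈U with w ≟ r
      ...   | yes refl = x∈⁅x⁆ r
      ...   | no  w≢r  = ⊥-elim (colored-separates u-col (λ r≡w → w≢r (sym r≡w)) (E-sym e) (E-sym e′)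
                                   (reverseʷ (walkTo r∈U) ++ʷ walkTo w∈U))
      r∈ : ⁅ r ⁆ ⊆ neighbours u
      r∈ {w} w∈ = subst (_∈ neighbours u) (sym (x∈⁅y⁆⇒x≡y r w∈))
                        (∈-subsetOf⁺ (trunkEdge? u) (E-sym e , inj₂ r∈U))

    S-candidate : TrunkCandidate F c S
    S-candidate = S-subgraph , S-connected , S-leaves

    -- A walk from v
    -- inside T′ stays in U until it reaches a colored vertex; such a vertex
    -- is a leaf of T′, so its only T′-edge leads back into U.
    candidate⊆S : ∀ T′ → TrunkCandidate F c T′ → v ∈ vs T′ → T′ ⊆S S
    candidate⊆S T′ ((inF , T′-sym) , T′-connected , T′-leaves) v∈T′ =
      (λ y∈T′ → reached⇒vertex (reached y∈T′)) ,
      (λ y {z} m → reached⇒edge (reached (proj₁ (proj₂ (inF y z m)))) m)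
      where
      Reached : Fin n → Set
      Reached y = y ∈ U ⊎ (¬ Uncolored y × ∃ λ u → u ∈ U × SEdge T′ y u)

      leaf-edge : ∀ {y u z} → ¬ Uncolored y → SEdge T′ y u → SEdge T′ y z → z ≡ u
      leaf-edge {y} {u} ¬uy m₁ m₂ =
        size1⇒≡ (lookup (es T′) y) (T′-leaves y (proj₁ (proj₂ (inF y u m₁))) ¬uy) m₁ m₂

      reached-step : ∀ {y z} → Reached y → SEdge T′ y z → Reached z
      reached-step {y} {z} (inj₁ y∈U) m with uncolored? z
      ... | yes uz = inj₁ (U-closed y∈U uz (proj₁ (inF y z m)))
      ... | no ¬uz = inj₂ (¬uz , y , y∈U , T′-sym y z m)
      reached-step (inj₂ (¬uy , u , u∈U , m₁)) m₂ = inj₁ (subst (_∈ U) (sym (leaf-edge ¬uy m₁ m₂)) u∈U)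

      reached-star : ∀ {a b} → Reached a → Star (SEdge T′) a b → Reached b
      reached-star ra ε        = ra
      reached-star ra (m ◅ ms) = reached-star (reached-step ra m) ms

      reached : ∀ {y} → y ∈ vs T′ → Reached y
      reached y∈T′ = reached-star (inj₁ v∈U) (T′-connected v _ v∈T′ y∈T′)

      reached⇒vertex : ∀ {z} → Reached z → z ∈ vs S
      reached⇒vertex (inj₁ z∈U) = U⊆S z∈U
      reached⇒vertex {z} (inj₂ (¬uz , u , u∈U , m)) =
        ∈-subsetOf⁺ inTrunk? (inj₂ (¬uz , u , u∈U , E-sym (proj₁ (inF z u m))))

      reached⇒edge : ∀ {y z} → Reached y → SEdge T′ y z → SEdge S y z
      reached⇒edge {y} {z} (inj₁ y∈U) m = edge⁺ (proj₁ (inF y z m) , inj₁ y∈U)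
      reached⇒edge {y} {z} (inj₂ (¬uy , u , u∈U , m₁)) m =
        edge⁺ (proj₁ (inF y z m) , inj₂ (subst (_∈ U) (sym (leaf-edge ¬uy m₁ m)) u∈U))

    S-maximal : ∀ T′ → TrunkCandidate F c T′ → S ⊆S T′ → T′ ≡ S
    S-maximal T′ cand S⊆T′ = cong₂ sg vs-equal es-equal
      where
      T′⊆S : T′ ⊆S S
      T′⊆S = candidate⊆S T′ cand (proj₁ S⊆T′ v∈S)
      vs-equal : vs T′ ≡ vs S
      vs-equal = ⊆-antisym (proj₁ T′⊆S) (proj₁ S⊆T′)
      es-equal : es T′ ≡ es S
      es-equal = trans (sym (tabulate∘lookup (es T′)))
                       (trans (tabulate-cong (λ u → ⊆-antisym (proj₂ T′⊆S u) (proj₂ S⊆T′ u)))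
                              (tabulate∘lookup (es S)))

    S-trunk : IsTrunk F c S
    S-trunk = S-candidate , S-maximal

    trunk-unique : ∀ T′ → IsTrunk F c T′ → v ∈ vs T′ → T′ ≡ S
    trunk-unique T′ (cand , maximal) v∈T′ = sym (maximal S S-candidate (candidate⊆S T′ cand v∈T′))

-- An
-- uncolored vertex without a legal color has k distinct neighbours (one of
-- each color).  Hence, once every uncolored vertex has fewer than k
-- neighbours, no vertex can ever become dead and Alice wins however the
-- remaining moves are played.
module LowDegreeColoringGame {n k : ℕ} (Adj : Fin n → Fin n → Set) (adj? : ∀ u w → Dec (Adj u w)) where
  open Game Adj k

  _≟ᶜ_ : (p q : Maybe (Fin k)) → Dec (p ≡ q)
  _≟ᶜ_ = ≡-dec _≟_

  uncolored? : ∀ c → Decidable (Uncolored c)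
  uncolored? c u = c u ≟ᶜ nothing

  legal? : ∀ c u a → Dec (Legal c u a)
  legal? c u a = all? (λ w → adj? u w →-dec ¬? (c w ≟ᶜ just a))

  update : Coloring → Fin n → Fin k → Coloring
  update c u a w with w ≟ u
  ... | yes _ = just a
  ... | no _  = c w

  update-spec : ∀ c u a → Update c u a (update c u a)
  update-spec c u a = at-u , off-u
    where
    at-u : update c u a u ≡ just a
    at-u with u ≟ u
    ... | yes _  = refl
    ... | no u≢u = ⊥-elim (u≢u refl)
    off-u : ∀ w → w ≢ u → update c u a w ≡ c w
    off-u w w≢u with w ≟ u
    ... | yes w≡u = ⊥-elim (w≢u w≡u)
    ... | no _    = refl

  illegal⇒neighbour : ∀ c u a → ¬ Legal c u a → ∃ λ w → Adj u w × c w ≡ just a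
  illegal⇒neighbour c u a ¬legal with ¬∀⟶∃¬ n _ (λ w → adj? u w →-dec ¬? (c w ≟ᶜ just a)) ¬legal
  ... | w , ¬free with adj? u w | c w ≟ᶜ just a
  ...   | yes e  | yes cw≡a = w , e , cw≡a
  ...   | yes _  | no cw≢a  = ⊥-elim (¬free λ _ → cw≢a)
  ...   | no ¬e  | _        = ⊥-elim (¬free λ e → ⊥-elim (¬e e))

  dead⇒degree≥k : ∀ c u → (∀ a → ¬ Legal c u a) → DegAtLeast Adj k u
  dead⇒degree≥k c u dead =
    List.tabulate (λ a → proj₁ (witness a)) , length-tabulate _ ,
    Unique.tabulate⁺ distinct , All.tabulate⁺ (λ a → proj₁ (proj₂ (witness a)))
    where
    witness : ∀ a → ∃ λ w → Adj u w × c w ≡ just a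
    witness a = illegal⇒neighbour c u a (dead a)
    distinct : ∀ {a b} → proj₁ (witness a) ≡ proj₁ (witness b) → a ≡ b
    distinct {a} {b} eq =
      just-injective (trans (sym (proj₂ (proj₂ (witness a)))) (trans (cong c eq) (proj₂ (proj₂ (witness b)))))

  LowDegree : Coloring → Set
  LowDegree c = ∀ u → Uncolored c u → ¬ DegAtLeast Adj k u

  lowDegree⇒noDead : ∀ {c} → LowDegree c → NoDead c
  lowDegree⇒noDead {c} low u uu dead = low u uu (dead⇒degree≥k c u dead)

  update-uncolored : ∀ {c c′ u a w} → Update c u a c′ → Uncolored c′ w → Uncolored c w
  update-uncolored {c} {c′} {u} {a} {w} (at-u , off-u) uw with w ≟ u
  ... | yes refl = ⊥-elim (just≢nothing (trans (sym at-u) uw))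
  ... | no w≢u   = trans (sym (off-u w w≢u)) uw

  uncoloredSet : Coloring → Subset n
  uncoloredSet c = subsetOf (uncolored? c)

  update-shrinks : ∀ {c c′ u a} → Uncolored c u → Update c u a c′ →
                   ∣ uncoloredSet c′ ∣ < ∣ uncoloredSet c ∣
  update-shrinks {c} {c′} {u} uu up@(at-u , _) =
    ≤-<-trans (p⊆q⇒∣p∣≤∣q∣ ⊆-minus-u) (x∈p⇒∣p-x∣<∣p∣ (∈-subsetOf⁺ (uncolored? c) uu))
    where
    ⊆-minus-u : uncoloredSet c′ ⊆ uncoloredSet c - u
    ⊆-minus-u {w} w∈ with w ≟ u
    ... | yes refl = ⊥-elim (just≢nothing (trans (sym at-u) (∈-subsetOf⁻ (uncolored? c′) w∈)))
    ... | no w≢u   =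
      x∈p∧x≢y⇒x∈p-y (∈-subsetOf⁺ (uncolored? c) (update-uncolored up (∈-subsetOf⁻ (uncolored? c′) w∈))) w≢u

  -- By induction on the number of uncolored vertices: Alice wins both when
  -- she is to move (any legal move will do) and when Bob is to move.
  lowDegree-wins : ∀ c → LowDegree c → AliceWins c × BobToMoveAliceWins c
  lowDegree-wins c = bounded (suc ∣ uncoloredSet c ∣) c ≤-refl
    where
    bounded : ∀ m c → ∣ uncoloredSet c ∣ < m → LowDegree c → AliceWins c × BobToMoveAliceWins c
    bounded zero    c () _
    bounded (suc m) c size<m low =
      alice-wins , b-move (lowDegree⇒noDead low) (λ u a uu _ c′ up → proj₁ (next uu up))
      where
      next : ∀ {u a c′} → Uncolored c u → Update c u a c′ → AliceWins c′ × BobToMoveAliceWins c′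
      next uu up = bounded m _ (<-≤-trans (update-shrinks uu up) (≤-pred size<m))
                             (λ w uw → low w (update-uncolored up uw))
      alice-wins : AliceWins c
      alice-wins with any? (uncolored? c)
      ... | no none = a-done all-colored
        where
        all-colored : AllColored c
        all-colored u with c u in cu
        ... | nothing = ⊥-elim (none (u , cu))
        ... | just a  = a , refl
      ... | yes (u , uu) with any? (legal? c u)
      ...   | no none       = ⊥-elim (lowDegree⇒noDead low u uu (λ a legal → none (a , legal)))
      ...   | yes (a , legal) =
        a-move (lowDegree⇒noDead low) u a uu legal (update c u a) (update-spec c u a)
               (proj₂ (next uu (update-spec c u a)))

module _ {V : Set} (Adj : V → V → Set) where

  reduce-keeps-high : ∀ {x} → DegAtLeast Adj 3 x → DegAtLeast (Reduce Adj) 3 x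
  reduce-keeps-high d@(ys , len≡ , ys! , adjacent) = ys , len≡ , ys! , All.map (λ e → e , inj₁ d) adjacent

  reduce-degree : ∀ {k x} → DegAtLeast (Reduce Adj) k x → DegAtLeast Adj k x
  reduce-degree (ys , len≡ , ys! , adjacent) = ys , len≡ , ys! , All.map proj₁ adjacent

module Simulation {n : ℕ} (F : Forest n) (c₀ : PColoring n) where
  open UncoloredWalks F c₀
  module GF = Game (FAdj F) 3
  module GR = Game (R'Adj F c₀) 3
  open LowDegreeColoringGame {k = 3} (FAdj F) (λ u w → T? (adj F u w))
    using (update; update-spec; illegal⇒neighbour; dead⇒degree≥k; LowDegree; lowDegree-wins)

  RV : Set
  RV = RVert F c₀

  RE : RV → RV → Set
  RE = RAdj

  copy : ∀ u → Uncolored u → RV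
  copy u uu = rv (TrunkAt.S u uu) (TrunkAt.S-trunk u uu) u (TrunkAt.v∈S u uu)

  neighbourCopy : ∀ {u w} (uu : Uncolored u) → E u w → RV
  neighbourCopy {u} {w} uu e =
    rv (TrunkAt.S u uu) (TrunkAt.S-trunk u uu) w (TrunkAt.neighbour∈S u uu (TrunkAt.v∈U u uu) e)

  copy-adjacent : ∀ {u w} (uu : Uncolored u) (e : E u w) → RE (copy u uu) (neighbourCopy uu e)
  copy-adjacent uu e = refl , TrunkAt.edge⁺ _ uu (e , inj₁ (TrunkAt.v∈U _ uu))

  copy-neighbour : ∀ {u} (uu : Uncolored u) {y} → RE (copy u uu) y → E u (vtx y)
  copy-neighbour uu (_ , m) = proj₁ (TrunkAt.edge⁻ _ uu m)

  -- An uncolored vertex has only one copy: the trunk through it is unique,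
  -- and the trunk proofs in RVert are irrelevant.  Decidability of subgraph
  -- equality recovers the (relevant) equation of trunks from an irrelevant proof.
  copy-unique : ∀ (x : RV) {u} (uu : Uncolored u) → vtx x ≡ u → x ≡ copy u uu
  copy-unique (rv t t-trunk u u∈t) uu refl =
    same-trunk (recompute (subgraph-≟ t (TrunkAt.S u uu)) (TrunkAt.trunk-unique u uu t t-trunk u∈t))
    where
    same-trunk : t ≡ TrunkAt.S u uu → rv t t-trunk u u∈t ≡ copy u uu
    same-trunk refl = refl

  degree-lift : ∀ {k u} (uu : Uncolored u) → DegAtLeast E k u → DegAtLeast RE k (copy u uu)
  degree-lift {u = u} uu (ws , len≡ , ws! , adjacent) =
    lift ws adjacent , trans (lift-length ws adjacent) len≡ ,
    lift-unique ws adjacent ws! , lift-adjacent ws adjacent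
    where
    lift : ∀ ws → All (E u) ws → List RV
    lift []       []       = []
    lift (w ∷ ws) (e ∷ es) = neighbourCopy uu e ∷ lift ws es

    lift-length : ∀ ws es → length (lift ws es) ≡ length ws
    lift-length []       []       = refl
    lift-length (w ∷ ws) (e ∷ es) = cong suc (lift-length ws es)

    lift-adjacent : ∀ ws es → All (RE (copy u uu)) (lift ws es)
    lift-adjacent []       []       = []
    lift-adjacent (w ∷ ws) (e ∷ es) = copy-adjacent uu e ∷ lift-adjacent ws es

    lift-distinct : ∀ {w} (e : E u w) ws es → All (w ≢_) ws → All (neighbourCopy uu e ≢_) (lift ws es)
    lift-distinct e []       []       []           = []
    lift-distinct e (w ∷ ws) (e′ ∷ es) (w≢ ∷ ws≢) = (λ eq → w≢ (cong vtx eq)) ∷ lift-distinct e ws es ws≢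

    lift-unique : ∀ ws es → Unique ws → Unique (lift ws es)
    lift-unique []       []       []          = []
    lift-unique (w ∷ ws) (e ∷ es) (w∉ ∷ ws!) = lift-distinct e ws es w∉ ∷ lift-unique ws es ws!

  Mirrors : PColoring n → (RV → Maybe (Fin 3)) → Set
  Mirrors cF cR = (∀ x → cR x ≡ cF (vtx x)) × (∀ u a → c₀ u ≡ just a → cF u ≡ just a)

  still-uncolored : ∀ {cF cR u} → Mirrors cF cR → cF u ≡ nothing → Uncolored u
  still-uncolored {u = u} (_ , precolored) uF with c₀ u in c₀u
  ... | nothing = refl
  ... | just a  = ⊥-elim (just≢nothing (trans (sym (precolored u a c₀u)) uF))

  -- A dead vertex of F has three differently colored neighbours, so its
  -- copy keeps these edges in R'(F) and is dead there as well.
  mirror-noDead : ∀ {cF cR} → Mirrors cF cR → GR.NoDead cR → GF.NoDead cF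
  mirror-noDead {cF} {cR} (mirror , precolored) noDead u uF dead =
    noDead (copy u uu) (trans (mirror (copy u uu)) uF) copy-dead
    where
    uu : Uncolored u
    uu = still-uncolored (mirror , precolored) uF
    high : DegAtLeast RE 3 (copy u uu)
    high = degree-lift uu (dead⇒degree≥k cF u dead)
    copy-dead : ∀ a → ¬ GR.Legal cR (copy u uu) a
    copy-dead a legal with illegal⇒neighbour cF u a (dead a)
    ... | w , e , cw≡a = legal (neighbourCopy uu e) (copy-adjacent uu e , inj₁ high) (trans (mirror _) cw≡a)

  -- When all RCG-relevant vertices are colored, every uncolored vertex of F
  -- has degree < 3 (otherwise its copy would be relevant and uncolored).
  mirror-lowDegree : ∀ {cF cR} → Mirrors cF cR → GR.AllHighColored cR → LowDegree cF
  mirror-lowDegree {cF} {cR} (mirror , precolored) allHigh u uF high =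
    just≢nothing (trans (sym (proj₂ copy-colored)) (trans (mirror (copy u uu)) uF))
    where
    uu : Uncolored u
    uu = still-uncolored (mirror , precolored) uF
    copy-colored : ∃ λ a → cR (copy u uu) ≡ just a
    copy-colored = allHigh (copy u uu) (reduce-keeps-high RE {copy u uu} (degree-lift uu high))

  mirrors-update : ∀ {cF cR cF′ cR′ u a} (uu : Uncolored u) → Mirrors cF cR →
                   GF.Update cF u a cF′ → GR.Update cR (copy u uu) a cR′ → Mirrors cF′ cR′
  mirrors-update {cF} {cR} {cF′} {cR′} {u} {a} uu (mirror , precolored) (F-at , F-off) (R-at , R-off) =
    mirror′ , precolored′
    where
    mirror′ : ∀ y → cR′ y ≡ cF′ (vtx y)
    mirror′ y with vtx y ≟ u
    ... | yes vtx≡u = begin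
      cR′ y            ≡⟨ cong cR′ (copy-unique y uu vtx≡u) ⟩
      cR′ (copy u uu)  ≡⟨ R-at ⟩
      just a           ≡⟨ sym F-at ⟩
      cF′ u            ≡⟨ cong cF′ (sym vtx≡u) ⟩
      cF′ (vtx y)      ∎
    ... | no vtx≢u = begin
      cR′ y            ≡⟨ R-off y (λ y≡copy → vtx≢u (cong vtx y≡copy)) ⟩
      cR y             ≡⟨ mirror y ⟩
      cF (vtx y)       ≡⟨ sym (F-off (vtx y) vtx≢u) ⟩
      cF′ (vtx y)      ∎
    precolored′ : ∀ w b → c₀ w ≡ just b → cF′ w ≡ just b
    precolored′ w b c₀w with w ≟ u
    ... | yes refl = ⊥-elim (just≢nothing (trans (sym c₀w) uu))
    ... | no w≢u   = trans (F-off w w≢u) (precolored w b c₀w)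

  alice-legal : ∀ {cF cR u a} (uu : Uncolored u) → Mirrors cF cR →
                GR.High (copy u uu) → GR.Legal cR (copy u uu) a → GF.Legal cF u a
  alice-legal {u = u} uu (mirror , _) high legal w e cw≡a =
    legal (neighbourCopy uu e) (copy-adjacent uu e , inj₁ (reduce-degree RE {x = copy u uu} high))
          (trans (mirror _) cw≡a)

  bob-legal : ∀ {cF cR u a} (uu : Uncolored u) → Mirrors cF cR →
              GF.Legal cF u a → GR.Legal cR (copy u uu) a
  bob-legal uu (mirror , _) legal y (adjacent , _) cy≡a =
    legal (vtx y) (copy-neighbour uu {y} adjacent) (trans (sym (mirror y)) cy≡a)

  bob-update : ∀ {cF cR cF′ u a} (uu : Uncolored u) → Mirrors cF cR →
               GF.Update cF u a cF′ → GR.Update cR (copy u uu) a (λ y → cF′ (vtx y))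
  bob-update {cF} {cR} {cF′} {u} uu (mirror , _) (F-at , F-off) = F-at , R-off
    where
    R-off : ∀ y → y ≢ copy u uu → cF′ (vtx y) ≡ cR y
    R-off y y≢copy with vtx y ≟ u
    ... | yes vtx≡u = ⊥-elim (y≢copy (copy-unique y uu vtx≡u))
    ... | no vtx≢u  = trans (F-off (vtx y) vtx≢u) (sym (mirror y))

  mutual
    aliceToMove : ∀ {cF cR} → Mirrors cF cR → GR.RCG-AliceWins cR → GF.AliceWins cF
    aliceToMove m (GR.ra-done _ allHigh) = proj₁ (lowDegree-wins _ (mirror-lowDegree m allHigh))
    aliceToMove {cF} {cR} m (GR.ra-move noDead x a high ux legal cR′ up next) =
      GF.a-move (mirror-noDead m noDead) u a uF
        (alice-legal uu m (subst GR.High x≡copy high) (subst (λ y → GR.Legal cR y a) x≡copy legal))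
        (update cF u a) (update-spec cF u a)
        (bobToMove (mirrors-update uu m (update-spec cF u a) (subst (λ y → GR.Update cR y a cR′) x≡copy up))
                   next)
      where
      u = vtx x
      uF : cF u ≡ nothing
      uF = trans (sym (proj₁ m x)) ux
      uu : Uncolored u
      uu = still-uncolored m uF
      x≡copy : x ≡ copy u uu
      x≡copy = copy-unique x uu refl

    bobToMove : ∀ {cF cR} → Mirrors cF cR → GR.RCG-BobToMoveAliceWins cR → GF.BobToMoveAliceWins cF
    bobToMove m (GR.rb-done _ allHigh) = proj₂ (lowDegree-wins _ (mirror-lowDegree m allHigh))
    bobToMove {cF} {cR} m (GR.rb-move noDead _ reply) = GF.b-move (mirror-noDead m noDead) respond
      where
      respond : ∀ u a → cF u ≡ nothing → GF.Legal cF u a → ∀ cF′ → GF.Update cF u a cF′ → GF.AliceWins cF′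
      respond u a uF legal cF′ up =
        aliceToMove (mirrors-update uu m up (bob-update uu m up))
          (reply (copy u uu) a (trans (proj₁ m _) uF) (bob-legal uu m legal) _ (bob-update uu m up))
        where
        uu : Uncolored u
        uu = still-uncolored m uF

  -- Initially R(F) carries the inherited coloring, and Bob (who moves first
  -- in the RCG) passes so that Alice can open as she does in F.
  simulate : GR.AliceWinsRCG (RColoring F c₀) → GF.AliceWinsColoringGame c₀
  simulate (GR.rb-done _ allHigh) = proj₁ (lowDegree-wins c₀ (mirror-lowDegree initial allHigh))
    where
    initial : Mirrors c₀ (RColoring F c₀)
    initial = (λ _ → refl) , (λ _ _ c₀u → c₀u)
  simulate (GR.rb-move _ pass _) = aliceToMove ((λ _ → refl) , (λ _ _ c₀u → c₀u)) pass

lemma6p1 : {n : ℕ} (F : Forest n) (c : PColoring n) → Proper F c →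
    Game.AliceWinsRCG (R'Adj F c) 3 (RColoring F c) →
    Game.AliceWinsColoringGame (FAdj F) 3 c
lemma6p1 F c _ = Simulation.simulate F c
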